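{- Let $E_3^*$ be the greedy set of positive integers free of exponential progressions. Then the exponential density of $\mathbb{N}\setminus E_3^*$ exists and equals $1/4$.
   Context: An exponential progression is a triple $x, x^n, x^{n^2}$ with $x,n$ natural numbers greater than $1$. $E_3^*$ is built greedily: going through $1,2,3,\dots$ in order, each integer is included unless it is the largest term of an exponential progression whose two smaller terms are already included. For $A\subseteq\mathbb{N}$, the upper exponential density is $\overline{e}(A)=\limsup_{n\to\infty}\frac{1}{\log n}\log\#\{a\in A:a\le n\}$, the lower exponential density $\underline{e}(A)$ is the corresponding $\liminf$, and the exponential density $e(A)$ is their common value when they agree. -}

module Defs where

open import Data.Bool using (Bool; true; false; if_then_else_; _∧_)
open import Data.Nat using (ℕ; zero; suc; _+_; _*_; _∸_; _^_; _≡ᵇ_; _≤ᵇ_)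
open import Data.List using (List; []; _∷_; _++_; [_]; upTo; length)
open import Data.Bool.ListAction using (any)

memᵇ : ℕ → List ℕ → Bool
memᵇ m L = any (λ y → m ≡ᵇ y) L

-- blocked m L : m is the largest term x^(k*k) of an exponential progression
-- x , x^k , x^(k^2) with x ≥ 2, k ≥ 2 whose two smaller terms x and x^k lie in L.
-- x ranges over L; k ranges over 0..m-1 (sufficient since k^2 < 2^(k^2) ≤ x^(k^2) = m).
blocked : ℕ → List ℕ → Bool
blocked m L =
  any (λ x → any (λ k → (2 ≤ᵇ x) ∧ (2 ≤ᵇ k) ∧ memᵇ (x ^ k) L ∧ (x ^ (k * k) ≡ᵇ m))
                 (upTo m))
      L

E≤ : ℕ → List ℕ
E≤ zero = []
E≤ (suc n) = if blocked (suc n) (E≤ n) then E≤ n else E≤ n ++ [ suc n ]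

complCount : ℕ → ℕ
complCount n = n ∸ length (E≤ n)

{-# OPTIONS --safe #-}
-- Let C(n) count the rejected m ≤ n. Each of them is x^(k²) with x, k ≥ 2. For k = 2 there are
-- at most about n^(1/4) such m; for k ≥ 3 we need x ≤ n^(1/9) and 2^(k²) ≤ n, which leaves at most
-- n^(1/9)·√(log₂ n) = o(n^(1/4)) more. Conversely, for x = 4c+2 neither x nor x² is a k²-th power
-- (such a power is odd or divisible by 16), so both are accepted and x⁴ is rejected.
-- Hence C(n)⁴ ≍ n, and the theorem is this estimate raised to integer powers.
module Submission where

open import Defs
open import Data.Bool using (Bool; true; false; T; if_then_else_; _∧_)
open import Data.Bool.Properties using (T-∧)
open import Data.Empty using (⊥-elim)
open import Data.List using (List; []; _∷_; _++_; [_]; map; upTo; length; cartesianProductWith)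
open import Data.List.Properties using (length-++; length-map; length-upTo)
open import Data.List.Membership.Propositional using (_∈_; lose)
open import Data.List.Membership.Propositional.Properties using (∈-upTo⁺; ∈-map⁺; ∈-++⁺ˡ; ∈-++⁺ʳ)
open import Data.List.Relation.Unary.Any using (here; there; satisfied)
open import Data.List.Relation.Unary.Any.Properties using (any⁺; any⁻; cartesianProductWith⁺)
open import Data.Nat
open import Data.Nat.Properties
open import Data.Nat.Divisibility using (_∣_; divides; ∣-refl; ∣-trans; ∣1⇒≡1; ∣⇒≤; *-pres-∣; m∣m*n; ∣m∣n⇒∣m+n; ∣m+n∣m⇒∣n)
open import Data.Nat.Primality using (Prime; prime[2]; ¬prime[1]; euclidsLemma)
open import Data.Nat.Tactic.RingSolver using (solve-∀)
open import Data.Product using (∃; ∃₂; _×_; _,_)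
open import Data.Sum using (inj₁; inj₂)
open import Function.Bundles using (Equivalence)
open import Relation.Binary.Definitions using (Monotonic₁; tri<; tri≈; tri>)
open import Relation.Binary.PropositionalEquality using (_≡_; _≢_; refl; sym; trans; cong; cong₂; subst; module ≡-Reasoning)
open import Relation.Nullary using (¬_; yes; no; contradiction)

open Equivalence using (to; from)

^-distribʳ-* : ∀ m n o → (m * n) ^ o ≡ m ^ o * n ^ o
^-distribʳ-* m n zero    = refl
^-distribʳ-* m n (suc o) =
  trans (cong (m * n *_) (^-distribʳ-* m n o)) ([m*n]*[o*p]≡[m*o]*[n*p] m n (m ^ o) (n ^ o))

^-cancelʳ-≤ : ∀ k .{{_ : NonZero k}} {m n} → m ^ k ≤ n ^ k → m ≤ n
^-cancelʳ-≤ k mᵏ≤nᵏ = ≮⇒≥ (λ n<m → <⇒≱ (^-monoˡ-< k n<m) mᵏ≤nᵏ)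

n≤n^[1+k] : ∀ n k → n ≤ n ^ suc k
n≤n^[1+k] zero    k = z≤n
n≤n^[1+k] (suc n) k = m≤m*n (suc n) (suc n ^ k) {{m^n≢0 (suc n) k}}

n<2^n : ∀ n → n < 2 ^ n
n<2^n zero    = s≤s z≤n
n<2^n (suc n) = begin-strict
  suc n            <⟨ s≤s (n<2^n n) ⟩
  suc (2 ^ n)      ≡⟨ +-comm 1 (2 ^ n) ⟩
  2 ^ n + 1        ≤⟨ +-monoʳ-≤ (2 ^ n) (m^n>0 2 n) ⟩
  2 ^ n + 2 ^ n    ≡⟨ cong (2 ^ n +_) (sym (+-identityʳ (2 ^ n))) ⟩
  2 ^ suc n        ∎
  where open ≤-Reasoning

m*n≤m*m+n*n : ∀ m n → m * n ≤ m * m + n * n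
m*n≤m*m+n*n m n with ≤-total m n
... | inj₁ m≤n = ≤-trans (*-monoˡ-≤ n m≤n) (m≤n+m (n * n) (m * m))
... | inj₂ n≤m = ≤-trans (*-monoʳ-≤ m n≤m) (m≤m+n (m * m) (n * n))

[m+n]^k≤2^k*[m^k+n^k] : ∀ m n k → (m + n) ^ k ≤ 2 ^ k * (m ^ k + n ^ k)
[m+n]^k≤2^k*[m^k+n^k] m n k with ≤-total m n
... | inj₁ m≤n = begin
  (m + n) ^ k              ≤⟨ ^-monoˡ-≤ k (+-monoˡ-≤ n m≤n) ⟩
  (n + n) ^ k              ≡⟨ cong (λ t → (n + t) ^ k) (sym (+-identityʳ n)) ⟩
  (2 * n) ^ k              ≡⟨ ^-distribʳ-* 2 n k ⟩
  2 ^ k * n ^ k            ≤⟨ *-monoʳ-≤ (2 ^ k) (m≤n+m (n ^ k) (m ^ k)) ⟩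
  2 ^ k * (m ^ k + n ^ k)  ∎
  where open ≤-Reasoning
... | inj₂ n≤m = begin
  (m + n) ^ k              ≤⟨ ^-monoˡ-≤ k (+-monoʳ-≤ m n≤m) ⟩
  (m + m) ^ k              ≡⟨ cong (λ t → (m + t) ^ k) (sym (+-identityʳ m)) ⟩
  (2 * m) ^ k              ≡⟨ ^-distribʳ-* 2 m k ⟩
  2 ^ k * m ^ k            ≤⟨ *-monoʳ-≤ (2 ^ k) (m≤m+n (m ^ k) (n ^ k)) ⟩
  2 ^ k * (m ^ k + n ^ k)  ∎
  where open ≤-Reasoning

strictMono-reflects-< : ∀ {g : ℕ → ℕ} → Monotonic₁ _<_ _<_ g → ∀ {x y} → g x < g y → x < y
strictMono-reflects-< mono {x} {y} gx<gy with <-cmp x y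
... | tri< x<y _ _ = x<y
... | tri≈ _ refl _ = contradiction gx<gy (<-irrefl refl)
... | tri> _ _ y<x = contradiction (mono y<x) (<⇒≯ gx<gy)

root-bracket : ∀ {g : ℕ → ℕ} → Monotonic₁ _<_ _<_ g →
               ∀ n → g 0 ≤ n → ∃ λ r → g r ≤ n × n < g (suc r)
root-bracket mono zero    g0≤0 = 0 , g0≤0 , ≤-<-trans z≤n (mono z<s)
root-bracket {g} mono (suc n) g0≤1+n with g 0 ≤? n
... | no g0≰n = 0 , g0≤1+n , ≤-<-trans (≰⇒> g0≰n) (mono z<s)
... | yes g0≤n with root-bracket mono n g0≤n
...   | r , gr≤n , n<g[1+r] with g (suc r) ≤? suc n
...     | yes g[1+r]≤1+n = suc r , g[1+r]≤1+n , ≤-<-trans n<g[1+r] (mono (n<1+n (suc r)))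
...     | no g[1+r]≰1+n  = r , m≤n⇒m≤1+n gr≤n , ≰⇒> g[1+r]≰1+n

root : ∀ {g : ℕ → ℕ} → Monotonic₁ _<_ _<_ g →
       ∀ n → g 0 ≤ n → ∃ λ r → g r ≤ n × (∀ x → g x ≤ n → x ≤ r)
root mono n g0≤n with root-bracket mono n g0≤n
... | r , gr≤n , n<g[1+r] = r , gr≤n , λ x gx≤n → s≤s⁻¹ (strictMono-reflects-< mono (≤-<-trans gx≤n n<g[1+r]))

suc-root-bound : ∀ e {r n} → 1 ≤ n → r ^ e ≤ n → suc r ^ e ≤ 2 ^ e * n
suc-root-bound e {zero}  {n} 1≤n _    = subst (_≤ 2 ^ e * n) (sym (^-zeroˡ e)) (*-mono-≤ (m^n>0 2 e) 1≤n)
suc-root-bound e {suc r} {n} _   rᵉ≤n = begin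
  (2 + r) ^ e        ≤⟨ ^-monoˡ-≤ e (≤-trans (s≤s (m≤n+m (suc r) r)) (+-monoʳ-≤ (suc r) (m≤m+n (suc r) 0))) ⟩
  (2 * suc r) ^ e    ≡⟨ ^-distribʳ-* 2 (suc r) e ⟩
  2 ^ e * suc r ^ e  ≤⟨ *-monoʳ-≤ (2 ^ e) rᵉ≤n ⟩
  2 ^ e * n          ∎
  where open ≤-Reasoning

suc-logRoot-bound : ∀ e {u n} → 2 ^ (u * u) ≤ n → suc u ^ e ≤ 2 ^ (e * e) * n
suc-logRoot-bound e {u} {n} 2^u²≤n = begin
  suc u ^ e               ≤⟨ ^-monoˡ-≤ e (n<2^n u) ⟩
  (2 ^ u) ^ e             ≡⟨ ^-*-assoc 2 u e ⟩
  2 ^ (u * e)             ≤⟨ ^-monoʳ-≤ 2 u*e≤e*e+u*u ⟩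
  2 ^ (e * e + u * u)     ≡⟨ ^-distribˡ-+-* 2 (e * e) (u * u) ⟩
  2 ^ (e * e) * 2 ^ (u * u) ≤⟨ *-monoʳ-≤ (2 ^ (e * e)) 2^u²≤n ⟩
  2 ^ (e * e) * n         ∎
  where
  open ≤-Reasoning
  u*e≤e*e+u*u : u * e ≤ e * e + u * u
  u*e≤e*e+u*u = subst (_≤ e * e + u * u) (*-comm e u) (m*n≤m*m+n*n e u)

-- 2-adic obstruction

prime∣^⇒∣ : ∀ {p y} j → Prime p → p ∣ y ^ j → p ∣ y
prime∣^⇒∣ zero    pp p∣1 = ⊥-elim (¬prime[1] (subst Prime (∣1⇒≡1 p∣1) pp))
prime∣^⇒∣ (suc j) pp p∣y*yʲ with euclidsLemma _ _ pp p∣y*yʲ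
... | inj₁ p∣y  = p∣y
... | inj₂ p∣yʲ = prime∣^⇒∣ j pp p∣yʲ

^-monoˡ-∣ : ∀ {m n} j → m ∣ n → m ^ j ∣ n ^ j
^-monoˡ-∣ zero    _   = ∣-refl
^-monoˡ-∣ (suc j) m∣n = *-pres-∣ m∣n (^-monoˡ-∣ j m∣n)

^-monoʳ-∣ : ∀ m {i j} → i ≤ j → m ^ i ∣ m ^ j
^-monoʳ-∣ m {i} {j} i≤j = subst (m ^ i ∣_) mⁱ*mʲ⁻ⁱ≡mʲ (m∣m*n (m ^ (j ∸ i)))
  where
  mⁱ*mʲ⁻ⁱ≡mʲ : m ^ i * m ^ (j ∸ i) ≡ m ^ j
  mⁱ*mʲ⁻ⁱ≡mʲ = trans (sym (^-distribˡ-+-* m i (j ∸ i))) (cong (m ^_) (m+[n∸m]≡n i≤j))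

d∤d*q+r : ∀ d q {r} → 0 < r → r < d → ¬ d ∣ d * q + r
d∤d*q+r d q 0<r r<d d∣dq+r = <⇒≱ r<d (∣⇒≤ {{>-nonZero 0<r}} (∣m+n∣m⇒∣n d∣dq+r (m∣m*n q)))

even-k²-power⇒16∣ : ∀ {y k} → 2 ≤ k → 2 ∣ y ^ (k * k) → 16 ∣ y ^ (k * k)
even-k²-power⇒16∣ {y} {k} 2≤k 2∣yᵏᵏ =
  ∣-trans (^-monoˡ-∣ 4 (prime∣^⇒∣ (k * k) prime[2] 2∣yᵏᵏ)) (^-monoʳ-∣ y (*-mono-≤ 2≤k 2≤k))

twiceOdd : ℕ → ℕ
twiceOdd c = 4 * c + 2

2∣twiceOdd : ∀ c → 2 ∣ twiceOdd c
2∣twiceOdd c = ∣m∣n⇒∣m+n (∣-trans (divides 2 refl) (m∣m*n c)) ∣-refl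

2∣twiceOdd² : ∀ c → 2 ∣ twiceOdd c ^ 2
2∣twiceOdd² c = ∣-trans (2∣twiceOdd c) (m∣m*n _)

16∤twiceOdd : ∀ c → ¬ 16 ∣ twiceOdd c
16∤twiceOdd c 16∣x = d∤d*q+r 4 c z<s (s≤s (s≤s (s≤s z≤n))) (∣-trans (divides 4 refl) 16∣x)

16∤twiceOdd² : ∀ c → ¬ 16 ∣ twiceOdd c ^ 2
16∤twiceOdd² c 16∣x² = d∤d*q+r 16 (c * c + c) z<s (s≤s (s≤s (s≤s (s≤s (s≤s z≤n)))))
  (subst (16 ∣_) (square c) 16∣x²)
  where
  square : ∀ v → (4 * v + 2) * ((4 * v + 2) * 1) ≡ 16 * (v * v + v) + 4
  square = solve-∀

blocked-sound : ∀ {m L} → T (blocked m L) → ∃₂ λ x k → 2 ≤ x × 2 ≤ k × x ^ (k * k) ≡ m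
blocked-sound {m} {L} bl with satisfied (any⁻ _ L bl)
... | x , some-k with satisfied (any⁻ _ (upTo m) some-k)
... | k , cond with to T-∧ cond
... | 2≤ᵇx , cond′ with to T-∧ cond′
... | 2≤ᵇk , cond″ with to T-∧ cond″
... | _ , xᵏᵏ≡ᵇm = x , k , ≤ᵇ⇒≤ 2 x 2≤ᵇx , ≤ᵇ⇒≤ 2 k 2≤ᵇk , ≡ᵇ⇒≡ (x ^ (k * k)) m xᵏᵏ≡ᵇm

memᵇ-complete : ∀ {m L} → m ∈ L → T (memᵇ m L)
memᵇ-complete {m} m∈L = any⁺ _ (lose m∈L (≡⇒≡ᵇ m m refl))

blocked-fourthPower : ∀ {x L} → 2 ≤ x → x ∈ L → x ^ 2 ∈ L → T (blocked (x ^ 4) L)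
blocked-fourthPower {x} {L} 2≤x x∈L x²∈L = any⁺ _ (lose x∈L (any⁺ _ (lose (∈-upTo⁺ 2<x⁴) cond)))
  where
  2<x⁴ : 2 < x ^ 4
  2<x⁴ = <-≤-trans (s≤s (s≤s (s≤s z≤n))) (^-monoˡ-≤ 4 2≤x)
  cond : T ((2 ≤ᵇ x) ∧ (2 ≤ᵇ 2) ∧ memᵇ (x ^ 2) L ∧ (x ^ (2 * 2) ≡ᵇ x ^ 4))
  cond = from (T-∧ {2 ≤ᵇ x}) (≤⇒≤ᵇ 2≤x , from (T-∧ {2 ≤ᵇ 2}) (_ ,
           from (T-∧ {memᵇ (x ^ 2) L}) (memᵇ-complete x²∈L , ≡⇒≡ᵇ (x ^ 4) _ refl)))

-- The greedy construction

rejected : ℕ → Bool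
rejected m = blocked m (E≤ (m ∸ 1))

countUpTo : (ℕ → Bool) → ℕ → ℕ
countUpTo b zero    = 0
countUpTo b (suc n) = if b (suc n) then suc (countUpTo b n) else countUpTo b n

countUpTo-≤-suc : ∀ b n → countUpTo b n ≤ countUpTo b (suc n)
countUpTo-≤-suc b n with b (suc n)
... | true  = n≤1+n _
... | false = ≤-refl

countUpTo-suc : ∀ {b} n → T (b (suc n)) → countUpTo b (suc n) ≡ suc (countUpTo b n)
countUpTo-suc {b} n hit with b (suc n)
... | true = refl

length-E≤+countRejected : ∀ n → length (E≤ n) + countUpTo rejected n ≡ n
length-E≤+countRejected zero    = refl
length-E≤+countRejected (suc n) with blocked (suc n) (E≤ n) | length-E≤+countRejected n
... | true  | eq = trans (+-suc (length (E≤ n)) _) (cong suc eq)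
... | false | eq = begin
  length (E≤ n ++ [ suc n ]) + c  ≡⟨ cong (_+ c) (length-++ (E≤ n)) ⟩
  length (E≤ n) + 1 + c           ≡⟨ +-assoc (length (E≤ n)) 1 c ⟩
  length (E≤ n) + suc c           ≡⟨ +-suc (length (E≤ n)) c ⟩
  suc (length (E≤ n) + c)         ≡⟨ cong suc eq ⟩
  suc n                           ∎
  where
  open ≡-Reasoning
  c : ℕ
  c = countUpTo rejected n

complCount≡countRejected : ∀ n → complCount n ≡ countUpTo rejected n
complCount≡countRejected n =
  trans (cong (_∸ length (E≤ n)) (sym (length-E≤+countRejected n))) (m+n∸m≡n (length (E≤ n)) _)

greedyStep-⊇ : ∀ b (L : List ℕ) m {x} → x ∈ L → x ∈ (if b then L else L ++ [ m ])
greedyStep-⊇ true  L m x∈L = x∈L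
greedyStep-⊇ false L m x∈L = ∈-++⁺ˡ x∈L

greedyStep-∋ : ∀ {b} (L : List ℕ) {m} → ¬ T b → m ∈ (if b then L else L ++ [ m ])
greedyStep-∋ {true}  L rejected = contradiction _ rejected
greedyStep-∋ {false} L _        = ∈-++⁺ʳ L (here refl)

accepted∈E≤ : ∀ {m n} → m ≤ n → ¬ T (rejected (suc m)) → suc m ∈ E≤ (suc n)
accepted∈E≤ {m} {n} m≤n accepted with m≤n⇒m<n∨m≡n m≤n
... | inj₁ (s≤s m≤n-1) = greedyStep-⊇ (blocked (suc n) (E≤ n)) (E≤ n) (suc n) (accepted∈E≤ m≤n-1 accepted)
... | inj₂ refl        = greedyStep-∋ (E≤ m) accepted

nonPower∈E≤ : ∀ {m n} → m ≤ n → (∀ y k → 2 ≤ k → y ^ (k * k) ≢ m) → m ∈ E≤ n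
nonPower∈E≤ {zero}          _         notPower = contradiction refl (notPower 0 2 ≤-refl)
nonPower∈E≤ {suc m} {suc n} (s≤s m≤n) notPower = accepted∈E≤ m≤n λ rej →
  let x , k , _ , 2≤k , xᵏᵏ≡1+m = blocked-sound {suc m} {E≤ m} rej in notPower x k 2≤k xᵏᵏ≡1+m

2∣∧16∤⇒∈E≤ : ∀ {m n} → 2 ∣ m → ¬ 16 ∣ m → m ≤ n → m ∈ E≤ n
2∣∧16∤⇒∈E≤ 2∣m 16∤m m≤n = nonPower∈E≤ m≤n λ { y k 2≤k refl → 16∤m (even-k²-power⇒16∣ 2≤k 2∣m) }

-- Lower bound

twiceOdd⁴-rejected : ∀ c {n} → twiceOdd c ^ 4 ≡ suc n → T (rejected (suc n))
twiceOdd⁴-rejected c {n} x⁴≡1+n = subst (λ m → T (blocked m (E≤ n))) x⁴≡1+n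
  (blocked-fourthPower 2≤x
    (2∣∧16∤⇒∈E≤ (2∣twiceOdd c) (16∤twiceOdd c) (subst (_≤ n) (^-identityʳ x) (xⁱ≤n 1 (s≤s (s≤s z≤n)))))
    (2∣∧16∤⇒∈E≤ (2∣twiceOdd² c) (16∤twiceOdd² c) (xⁱ≤n 2 (s≤s (s≤s (s≤s z≤n))))))
  where
  x : ℕ
  x = twiceOdd c
  2≤x : 2 ≤ x
  2≤x = m≤n+m 2 (4 * c)
  xⁱ≤n : ∀ i → i < 4 → x ^ i ≤ n
  xⁱ≤n i i<4 = s≤s⁻¹ (subst (x ^ i <_) x⁴≡1+n (^-monoʳ-< x 2≤x i<4))

countRejected-lower : ∀ n → ∃ λ c → c ≤ countUpTo rejected n × n < twiceOdd c ^ 4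
countRejected-lower zero = 0 , z≤n , s≤s z≤n
countRejected-lower (suc n) with countRejected-lower n
... | c , c≤C , n<x⁴ with suc n <? twiceOdd c ^ 4
...   | yes 1+n<x⁴ = c , ≤-trans c≤C (countUpTo-≤-suc rejected n) , 1+n<x⁴
...   | no  1+n≮x⁴ = suc c , 1+c≤C′ , subst (_< twiceOdd (suc c) ^ 4) x⁴≡1+n (^-monoˡ-< 4 x<x′)
  where
  x⁴≡1+n : twiceOdd c ^ 4 ≡ suc n
  x⁴≡1+n = ≤-antisym (≮⇒≥ 1+n≮x⁴) n<x⁴
  1+c≤C′ : suc c ≤ countUpTo rejected (suc n)
  1+c≤C′ = subst (suc c ≤_) (sym (countUpTo-suc n (twiceOdd⁴-rejected c x⁴≡1+n))) (s≤s c≤C)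
  x<x′ : twiceOdd c < twiceOdd (suc c)
  x<x′ = +-monoˡ-< 2 (*-monoʳ-< 4 (n<1+n c))

complCount-lower : ∀ n → 16 ≤ n → n ≤ 6 ^ 4 * complCount n ^ 4
complCount-lower n 16≤n with countRejected-lower n
... | zero  , _     , n<16 = contradiction n<16 (≤⇒≯ 16≤n)
... | suc c , 1+c≤C , n<x⁴ = begin
  n                          ≤⟨ <⇒≤ n<x⁴ ⟩
  twiceOdd (suc c) ^ 4       ≤⟨ ^-monoˡ-≤ 4 x≤6[1+c] ⟩
  (6 * suc c) ^ 4            ≡⟨ ^-distribʳ-* 6 (suc c) 4 ⟩
  6 ^ 4 * suc c ^ 4          ≤⟨ *-monoʳ-≤ (6 ^ 4) (^-monoˡ-≤ 4 1+c≤C) ⟩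
  6 ^ 4 * countUpTo rejected n ^ 4 ≡⟨ cong (λ C → 6 ^ 4 * C ^ 4) (sym (complCount≡countRejected n)) ⟩
  6 ^ 4 * complCount n ^ 4   ∎
  where
  open ≤-Reasoning
  x≤6[1+c] : twiceOdd (suc c) ≤ 6 * suc c
  x≤6[1+c] = ≤-trans (+-monoʳ-≤ (4 * suc c) (m≤m*n 2 (suc c))) (≤-reflexive (sym (*-distribʳ-+ (suc c) 4 2)))

-- Upper bound

atMost : ℕ → List ℕ → ℕ
atMost n []       = 0
atMost n (v ∷ vs) with v ≤? n
... | yes _ = suc (atMost n vs)
... | no  _ = atMost n vs

atMost≤length : ∀ n vs → atMost n vs ≤ length vs
atMost≤length n []       = z≤n
atMost≤length n (v ∷ vs) with v ≤? n
... | yes _ = s≤s (atMost≤length n vs)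
... | no  _ = m≤n⇒m≤1+n (atMost≤length n vs)

atMost-≤-suc : ∀ n vs → atMost n vs ≤ atMost (suc n) vs
atMost-≤-suc n []       = z≤n
atMost-≤-suc n (v ∷ vs) with v ≤? n | v ≤? suc n
... | yes _   | yes _   = s≤s (atMost-≤-suc n vs)
... | yes v≤n | no v≰1+n = contradiction (m≤n⇒m≤1+n v≤n) v≰1+n
... | no _    | yes _   = m≤n⇒m≤1+n (atMost-≤-suc n vs)
... | no _    | no _    = atMost-≤-suc n vs

atMost-<-suc : ∀ {n vs} → suc n ∈ vs → atMost n vs < atMost (suc n) vs
atMost-<-suc {n} {v ∷ vs} (here refl) with suc n ≤? n | suc n ≤? suc n
... | yes 1+n≤n | _          = contradiction 1+n≤n (<-irrefl refl)
... | no _      | yes _      = s≤s (atMost-≤-suc n vs)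
... | no _      | no 1+n≰1+n = contradiction ≤-refl 1+n≰1+n
atMost-<-suc {n} {v ∷ vs} (there 1+n∈vs) with v ≤? n | v ≤? suc n
... | yes _   | yes _    = s≤s (atMost-<-suc 1+n∈vs)
... | yes v≤n | no v≰1+n = contradiction (m≤n⇒m≤1+n v≤n) v≰1+n
... | no _    | yes _    = m≤n⇒m≤1+n (atMost-<-suc 1+n∈vs)
... | no _    | no _     = atMost-<-suc 1+n∈vs

-- countUpTo b grows only at hits of b, and atMost · vs grows strictly at each of them
countUpTo≤atMost : ∀ b n vs → (∀ m → m ≤ n → T (b m) → m ∈ vs) → countUpTo b n ≤ atMost n vs
countUpTo≤atMost b zero    vs hits⊆vs = z≤n
countUpTo≤atMost b (suc n) vs hits⊆vs with b (suc n) in hit | countUpTo≤atMost b n vs (λ m m≤n → hits⊆vs m (m≤n⇒m≤1+n m≤n))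
... | true  | ih = <-≤-trans (s≤s ih) (atMost-<-suc (hits⊆vs (suc n) ≤-refl (subst T (sym hit) _)))
... | false | ih = ≤-trans ih (atMost-≤-suc n vs)

countUpTo≤length : ∀ b n vs → (∀ m → m ≤ n → T (b m) → m ∈ vs) → countUpTo b n ≤ length vs
countUpTo≤length b n vs hits⊆vs = ≤-trans (countUpTo≤atMost b n vs hits⊆vs) (atMost≤length n vs)

length-cartesianProductWith : ∀ {A B C : Set} (f : A → B → C) xs ys →
                              length (cartesianProductWith f xs ys) ≡ length xs * length ys
length-cartesianProductWith f []       ys = refl
length-cartesianProductWith f (x ∷ xs) ys = begin
  length (map (f x) ys ++ cartesianProductWith f xs ys)    ≡⟨ length-++ (map (f x) ys) ⟩
  length (map (f x) ys) + length (cartesianProductWith f xs ys)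
    ≡⟨ cong₂ _+_ (length-map (f x) ys) (length-cartesianProductWith f xs ys) ⟩
  length ys + length xs * length ys                       ∎
  where open ≡-Reasoning

powerBox : ℕ → ℕ → ℕ → List ℕ
powerBox X Y K = map (_^ 4) (upTo X) ++ cartesianProductWith (λ x k → x ^ (k * k)) (upTo Y) (upTo K)

length-powerBox : ∀ X Y K → length (powerBox X Y K) ≡ X + Y * K
length-powerBox X Y K = begin
  length (powerBox X Y K)  ≡⟨ length-++ (map (_^ 4) (upTo X)) ⟩
  length (map (_^ 4) (upTo X)) + length (cartesianProductWith _ (upTo Y) (upTo K))
    ≡⟨ cong₂ _+_ (length-map (_^ 4) (upTo X)) (length-cartesianProductWith _ (upTo Y) (upTo K)) ⟩
  length (upTo X) + length (upTo Y) * length (upTo K)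
    ≡⟨ cong₂ _+_ (length-upTo X) (cong₂ _*_ (length-upTo Y) (length-upTo K)) ⟩
  X + Y * K                ∎
  where open ≡-Reasoning

complCount≤powerBox : ∀ n X Y K →
  (∀ x → x ^ 4 ≤ n → x < X) →
  (∀ x k → 2 ≤ x → 3 ≤ k → x ^ (k * k) ≤ n → x < Y × k < K) →
  complCount n ≤ X + Y * K
complCount≤powerBox n X Y K fourth-in higher-in = begin
  complCount n               ≡⟨ complCount≡countRejected n ⟩
  countUpTo rejected n       ≤⟨ countUpTo≤length rejected n (powerBox X Y K) rejected∈box ⟩
  length (powerBox X Y K)    ≡⟨ length-powerBox X Y K ⟩
  X + Y * K                  ∎
  where
  open ≤-Reasoning
  rejected∈box : ∀ m → m ≤ n → T (rejected m) → m ∈ powerBox X Y K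
  rejected∈box m m≤n rej with blocked-sound {m} {E≤ (m ∸ 1)} rej
  ... | x , k , 2≤x , 2≤k , refl with m≤n⇒m<n∨m≡n 2≤k
  ...   | inj₂ refl = ∈-++⁺ˡ (∈-map⁺ (_^ 4) (∈-upTo⁺ (fourth-in x m≤n)))
  ...   | inj₁ 3≤k  = let x<Y , k<K = higher-in x k 2≤x 3≤k m≤n in
    ∈-++⁺ʳ (map (_^ 4) (upTo X))
      (cartesianProductWith⁺ (λ x k → x ^ (k * k)) (λ { refl refl → refl }) (∈-upTo⁺ x<Y) (∈-upTo⁺ k<K))

product-ninthPower-bound : ∀ {a b n} α β → a ^ 9 ≤ α * n → b ^ 9 ≤ β * n → (a * b) ^ 9 ≤ α * β * (n * n)
product-ninthPower-bound {a} {b} {n} α β a⁹≤αn b⁹≤βn = begin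
  (a * b) ^ 9          ≡⟨ ^-distribʳ-* a b 9 ⟩
  a ^ 9 * b ^ 9        ≤⟨ *-mono-≤ a⁹≤αn b⁹≤βn ⟩
  (α * n) * (β * n)    ≡⟨ [m*n]*[o*p]≡[m*o]*[n*p] α n β n ⟩
  α * β * (n * n)      ∎
  where open ≤-Reasoning

fourthPower-bound : ∀ {z n} d .{{_ : NonZero n}} → z ^ 9 ≤ d ^ 9 * (n * n) → z ^ 4 ≤ d ^ 4 * n
fourthPower-bound {z} {n} d z⁹≤ = ^-cancelʳ-≤ 9 (begin
  (z ^ 4) ^ 9                ≡⟨ trans (^-*-assoc z 4 9) (sym (^-*-assoc z 9 4)) ⟩
  (z ^ 9) ^ 4                ≤⟨ ^-monoˡ-≤ 4 z⁹≤ ⟩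
  (d ^ 9 * (n * n)) ^ 4      ≡⟨ ^-distribʳ-* (d ^ 9) (n * n) 4 ⟩
  (d ^ 9) ^ 4 * (n * n) ^ 4  ≡⟨ cong₂ _*_ (^-*-assoc d 9 4) (trans (^-distribʳ-* n n 4) (sym (^-distribˡ-+-* n 4 4))) ⟩
  d ^ 36 * n ^ 8             ≤⟨ *-monoʳ-≤ (d ^ 36) (^-monoʳ-≤ n (n≤1+n 8)) ⟩
  d ^ 36 * n ^ 9             ≡⟨ cong (_* n ^ 9) (sym (^-*-assoc d 4 9)) ⟩
  (d ^ 4) ^ 9 * n ^ 9        ≡⟨ sym (^-distribʳ-* (d ^ 4) n 9) ⟩
  (d ^ 4 * n) ^ 9            ∎)
  where open ≤-Reasoning

complCount-upper : ∀ n → complCount n ^ 4 ≤ 2 ^ 4 * (2 ^ 4 + (2 ^ 10) ^ 4) * n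
complCount-upper zero      = z≤n
complCount-upper n@(suc _) = fromRoots
  (root {_^ 4} (^-monoˡ-< 4) n z≤n)
  (root {_^ 9} (^-monoˡ-< 9) n z≤n)
  (root {λ u → 2 ^ (u * u)} (λ u<v → ^-monoʳ-< 2 (s≤s (s≤s z≤n)) (*-mono-< u<v u<v)) n (s≤s z≤n))
  where
  fromRoots : (∃ λ r → r ^ 4 ≤ n × (∀ x → x ^ 4 ≤ n → x ≤ r)) →
              (∃ λ s → s ^ 9 ≤ n × (∀ x → x ^ 9 ≤ n → x ≤ s)) →
              (∃ λ u → 2 ^ (u * u) ≤ n × (∀ k → 2 ^ (k * k) ≤ n → k ≤ u)) →
              complCount n ^ 4 ≤ 2 ^ 4 * (2 ^ 4 + (2 ^ 10) ^ 4) * n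
  fromRoots (r , r⁴≤n , r-max) (s , s⁹≤n , s-max) (u , 2^u²≤n , u-max) = begin
    complCount n ^ 4                       ≤⟨ ^-monoˡ-≤ 4 (complCount≤powerBox n X Y K fourth-in higher-in) ⟩
    (X + Y * K) ^ 4                        ≤⟨ [m+n]^k≤2^k*[m^k+n^k] X (Y * K) 4 ⟩
    2 ^ 4 * (X ^ 4 + (Y * K) ^ 4)          ≤⟨ *-monoʳ-≤ (2 ^ 4) (+-mono-≤ X⁴≤ (fourthPower-bound {Y * K} {n} (2 ^ 10) [YK]⁹≤)) ⟩
    2 ^ 4 * (2 ^ 4 * n + (2 ^ 10) ^ 4 * n) ≡⟨ cong (2 ^ 4 *_) (sym (*-distribʳ-+ n (2 ^ 4) ((2 ^ 10) ^ 4))) ⟩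
    2 ^ 4 * ((2 ^ 4 + (2 ^ 10) ^ 4) * n)   ≡⟨ sym (*-assoc (2 ^ 4) (2 ^ 4 + (2 ^ 10) ^ 4) n) ⟩
    2 ^ 4 * (2 ^ 4 + (2 ^ 10) ^ 4) * n     ∎
    where
    open ≤-Reasoning
    X Y K : ℕ
    X = suc r
    Y = suc s
    K = suc u
    fourth-in : ∀ x → x ^ 4 ≤ n → x < X
    fourth-in x x⁴≤n = s≤s (r-max x x⁴≤n)
    higher-in : ∀ x k → 2 ≤ x → 3 ≤ k → x ^ (k * k) ≤ n → x < Y × k < K
    higher-in x k 2≤x 3≤k xᵏᵏ≤n =
      s≤s (s-max x (≤-trans (^-monoʳ-≤ x {{>-nonZero (<-≤-trans z<s 2≤x)}} (*-mono-≤ 3≤k 3≤k)) xᵏᵏ≤n)) ,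
      s≤s (u-max k (≤-trans (^-monoˡ-≤ (k * k) 2≤x) xᵏᵏ≤n))
    X⁴≤ : X ^ 4 ≤ 2 ^ 4 * n
    X⁴≤ = suc-root-bound 4 {r} {n} (s≤s z≤n) r⁴≤n
    2⁹*2⁸¹≡[2¹⁰]⁹ : 2 ^ 9 * 2 ^ 81 ≡ (2 ^ 10) ^ 9
    2⁹*2⁸¹≡[2¹⁰]⁹ = trans (sym (^-distribˡ-+-* 2 9 81)) (sym (^-*-assoc 2 10 9))
    [YK]⁹≤ : (Y * K) ^ 9 ≤ (2 ^ 10) ^ 9 * (n * n)
    [YK]⁹≤ = subst (λ c → (Y * K) ^ 9 ≤ c * (n * n)) 2⁹*2⁸¹≡[2¹⁰]⁹
      (product-ninthPower-bound {Y} {K} {n} (2 ^ 9) (2 ^ 81) (suc-root-bound 9 {s} {n} (s≤s z≤n) s⁹≤n) (suc-logRoot-bound 9 {u} {n} 2^u²≤n))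

-- Exponential density from f(n)⁴ ≍ n

scaledPower-≤ : ∀ {x y c z} k → x ≤ c * y → c ^ k ≤ z → x ^ k ≤ z * y ^ k
scaledPower-≤ {x} {y} {c} {z} k x≤cy cᵏ≤z = begin
  x ^ k          ≤⟨ ^-monoˡ-≤ k x≤cy ⟩
  (c * y) ^ k    ≡⟨ ^-distribʳ-* c y k ⟩
  c ^ k * y ^ k  ≤⟨ *-monoˡ-≤ (y ^ k) cᵏ≤z ⟩
  z * y ^ k      ∎
  where open ≤-Reasoning

fourthPowerComparable⇒density¼ : ∀ (f : ℕ → ℕ) A B N₀ →
  (∀ n → f n ^ 4 ≤ A * n) → (∀ n → N₀ ≤ n → n ≤ B * f n ^ 4) →
  (p q : ℕ) → ∃ λ N → (n : ℕ) → N ≤ n →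
    (f n ^ (4 * suc q) ≤ n ^ (suc q + 4 * suc p)) × (n ^ suc q ≤ f n ^ (4 * suc q) * n ^ (4 * suc p))
fourthPowerComparable⇒density¼ f A B N₀ upper lower p q = N₀ + (A ^ suc q + B ^ suc q) , bounds
  where
  bounds : ∀ n → N₀ + (A ^ suc q + B ^ suc q) ≤ n →
    (f n ^ (4 * suc q) ≤ n ^ (suc q + 4 * suc p)) × (n ^ suc q ≤ f n ^ (4 * suc q) * n ^ (4 * suc p))
  bounds n N≤n = upper-bound , lower-bound
    where
    open ≤-Reasoning
    P : ℕ
    P = 4 * suc p
    n≤nᴾ : n ≤ n ^ P
    n≤nᴾ = n≤n^[1+k] n (p + 3 * suc p)
    Aᵠ≤nᴾ : A ^ suc q ≤ n ^ P
    Aᵠ≤nᴾ = ≤-trans (m≤m+n _ _) (≤-trans (m≤n+m _ N₀) (≤-trans N≤n n≤nᴾ))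
    Bᵠ≤nᴾ : B ^ suc q ≤ n ^ P
    Bᵠ≤nᴾ = ≤-trans (m≤n+m _ _) (≤-trans (m≤n+m _ N₀) (≤-trans N≤n n≤nᴾ))
    upper-bound : f n ^ (4 * suc q) ≤ n ^ (suc q + P)
    upper-bound = begin
      f n ^ (4 * suc q)        ≡⟨ sym (^-*-assoc (f n) 4 (suc q)) ⟩
      (f n ^ 4) ^ suc q        ≤⟨ scaledPower-≤ {y = n} {c = A} (suc q) (upper n) Aᵠ≤nᴾ ⟩
      n ^ P * n ^ suc q        ≡⟨ *-comm (n ^ P) (n ^ suc q) ⟩
      n ^ suc q * n ^ P        ≡⟨ sym (^-distribˡ-+-* n (suc q) P) ⟩
      n ^ (suc q + P)          ∎
    lower-bound : n ^ suc q ≤ f n ^ (4 * suc q) * n ^ P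
    lower-bound = begin
      n ^ suc q                ≤⟨ scaledPower-≤ {y = f n ^ 4} {c = B} (suc q) (lower n (≤-trans (m≤m+n N₀ _) N≤n)) Bᵠ≤nᴾ ⟩
      n ^ P * (f n ^ 4) ^ suc q ≡⟨ *-comm (n ^ P) _ ⟩
      (f n ^ 4) ^ suc q * n ^ P ≡⟨ cong (_* n ^ P) (^-*-assoc (f n) 4 (suc q)) ⟩
      f n ^ (4 * suc q) * n ^ P ∎

mainTheorem5 : (p q : ℕ) → ∃ λ N → (n : ℕ) → N ≤ n →
    (complCount n ^ (4 * suc q) ≤ n ^ (suc q + 4 * suc p))
    × (n ^ suc q ≤ complCount n ^ (4 * suc q) * n ^ (4 * suc p))
mainTheorem5 = fourthPowerComparable⇒density¼ complCount (2 ^ 4 * (2 ^ 4 + (2 ^ 10) ^ 4)) (6 ^ 4) 16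
  complCount-upper complCount-lower
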